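{- Let $m\ge1$ and let $P=(p_{i,j})_{1\le j\le i\le m}$ be an integral Gelfand–Tsetlin pattern. Then $S(T(P))=\mathrm{rect}(C(P))$, where $S$ is the Schützenberger involution on semistandard Young tableaux with entries in $\{1,\dots,m\}$.
   Context: An integral Gelfand–Tsetlin (GT) pattern of size $m$ is a triangular array $P=(p_{i,j})_{1\le j\le i\le m}$ of nonnegative integers with $p_{i+1,j}\ge p_{i,j}\ge p_{i+1,j+1}$ for all valid indices. Set $P_i=(p_{i,1},\dots,p_{i,i},0,\dots,0)$ (a partition with $m$ parts) and $P_0=(0,\dots,0)$; then $P_{i}/P_{i-1}$ is a horizontal strip. $T(P)$ is the semistandard Young tableau of shape $P_m$ in which the boxes of $P_i/P_{i-1}$ contain the entry $i$ ($1\le i\le m$). Let $K=p_{m,1}$, $Q_i=(K-(P_i)_m,K-(P_i)_{m-1},\dots,K-(P_i)_1)$ for $1\le i\le m$ (where $(P_i)_j$ is the $j$-th component of $P_i$) and $Q_0=(K,\dots,K)$ ($m$ parts). Then $Q_m\subseteq Q_{m-1}\subseteq\cdots\subseteq Q_0$ with horizontal strip differences, and the contretableau $C(P)$ is the filling of the $m\times K$ rectangle in which boxes of $Q_m$ get $0$ (ignored) and boxes of $Q_{m-i}/Q_{m-i+1}$ get entry $i$; it is a semistandard tableau of skew shape $Q_0/Q_m$. $\mathrm{rect}(X)$ denotes the jeu de taquin rectification of a skew semistandard tableau $X$ (the unique semistandard Young tableau whose reading word is Knuth equivalent to that of $X$). The Schützenberger involution $S$ on semistandard Young tableaux with entries in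 $\{1,\dots,m\}$: $S(T)$ is the rectification of the skew tableau obtained by rotating $T$ by $180^\circ$ and replacing each entry $x$ by $m+1-x$. -}

module Defs where

open import Data.Nat using (ℕ; zero; suc; _∸_; _≤_; _<_; _≤ᵇ_)
open import Data.Bool using (if_then_else_; _∧_)
open import Data.List using (List; []; _∷_; _++_; map; concat; concatMap; reverse; replicate; applyUpTo; length)
open import Data.List.Relation.Unary.All using (All)
open import Data.List.Relation.Unary.Linked using (Linked)
open import Data.Product using (_×_; _,_; proj₂)
open import Data.Unit using (⊤)
open import Data.Empty using (⊥)
open import Relation.Nullary using (¬_)
open import Relation.Binary.PropositionalEquality using (_≡_)
open import Relation.Binary.Construct.Closure.Equivalence using (EqClosure)

-- Integral GT pattern of size m, stored as p i j (1-based, only 1 ≤ j ≤ i ≤ m matter):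
-- p (i+1) j ≥ p i j ≥ p (i+1) (j+1) for 1 ≤ j ≤ i ≤ m-1.
IsGT : ℕ → (ℕ → ℕ → ℕ) → Set
IsGT m p = ∀ i j → 1 ≤ j → j ≤ i → suc i ≤ m →
  (p i j ≤ p (suc i) j) × (p (suc i) (suc j) ≤ p i j)

range1 : ℕ → List ℕ
range1 n = applyUpTo suc n

-- (P_i)_j : j-th part of P_i (0 if j > i; P_0 = 0)
Ppart : (ℕ → ℕ → ℕ) → ℕ → ℕ → ℕ
Ppart p i j = if (1 ≤ᵇ j) ∧ (j ≤ᵇ i) then p i j else 0

-- Straight-shape fillings: list of rows, top to bottom (English convention).
Tableau : Set
Tableau = List (List ℕ)

-- Skew fillings: list of rows top to bottom; each row = (number of empty leading cells, entries).
SkewTableau : Set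
SkewTableau = List (ℕ × List ℕ)

T : ℕ → (ℕ → ℕ → ℕ) → Tableau
T m p = map (λ j → concatMap (λ i → replicate (Ppart p i j ∸ Ppart p (i ∸ 1) j) i) (range1 m)) (range1 m)

Qpart : ℕ → ℕ → (ℕ → ℕ → ℕ) → ℕ → ℕ → ℕ
Qpart m K p i r = K ∸ Ppart p i (suc m ∸ r)

C : ℕ → (ℕ → ℕ → ℕ) → SkewTableau
C m p = map row (range1 m)
  where
    K = p m 1
    row : ℕ → ℕ × List ℕ
    row r = Qpart m K p m r ,
            concatMap (λ i → replicate (Qpart m K p (m ∸ i) r ∸ Qpart m K p (suc m ∸ i) r) i) (range1 m)

readingWord : SkewTableau → List ℕ
readingWord t = concat (reverse (map proj₂ t))

data KnuthStep : List ℕ → List ℕ → Set where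
  k1 : ∀ u v x y z → x ≤ y → y < z →
       KnuthStep (u ++ x ∷ z ∷ y ∷ v) (u ++ z ∷ x ∷ y ∷ v)
  k2 : ∀ u v x y z → x < y → y ≤ z →
       KnuthStep (u ++ y ∷ x ∷ z ∷ v) (u ++ y ∷ z ∷ x ∷ v)

KnuthEquiv : List ℕ → List ℕ → Set
KnuthEquiv = EqClosure KnuthStep

-- Column strictness between a row and the row below it (also forces the lower row to be no longer).
ColStrict : List ℕ → List ℕ → Set
ColStrict _ [] = ⊤
ColStrict [] (_ ∷ _) = ⊥
ColStrict (a ∷ as) (b ∷ bs) = (a < b) × ColStrict as bs

IsSSYT : Tableau → Set
IsSSYT t = All (λ r → ¬ (r ≡ [])) t × All (Linked _≤_) t × Linked ColStrict t

asSkew : Tableau → SkewTableau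
asSkew t = map (λ r → 0 , r) t

IsRect : SkewTableau → Tableau → Set
IsRect X Y = IsSSYT Y × KnuthEquiv (readingWord X) (readingWord (asSkew Y))

firstRowLength : Tableau → ℕ
firstRowLength [] = 0
firstRowLength (r ∷ _) = length r

-- Rotate a straight tableau by 180° and replace x by m+1-x.
rotateComplement : ℕ → Tableau → SkewTableau
rotateComplement m t =
  reverse (map (λ r → (firstRowLength t ∸ length r , reverse (map (λ x → suc m ∸ x) r))) t)

IsSchutz : ℕ → Tableau → Tableau → Set
IsSchutz m t Y = IsRect (rotateComplement m t) Y

-- Rectification of a skew tableau X is computed by Schensted insertion: rect(X) is the
-- insertion tableau of the reading word of X. Indeed the insertion tableau is constant on
-- Knuth classes (an elementary Knuth move in a word changes the word bumped out of each row
-- by at most one Knuth move, so induction on the rows applies), every word is Knuth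
-- equivalent to the reading word of its insertion tableau, and inserting the reading word of
-- a semistandard tableau gives it back. Hence S(T(P)) and rect(C(P)) are both unique, and they
-- coincide once the reading word of T(P), rotated and complemented, is seen to equal the
-- reading word of C(P): row m − j of C(P) is row j + 1 of T(P) read backwards under
-- i ↦ m + 1 − i, because (K − (P_{i−1})_j) − (K − (P_i)_j) = (P_i)_j − (P_{i−1})_j, which uses
-- that every entry of P is at most K = p_{m,1}.
module Submission where

open import Defs
open import Data.Bool using (true; false) renaming (T to True)
open import Data.Empty using (⊥-elim)
open import Data.List
  using (List; []; _∷_; _++_; _∷ʳ_; foldl; concat; concatMap; reverse; map; replicate; applyUpTo; length)
open import Data.List.Membership.Propositional using (_∈_)
open import Data.List.Properties
  using (foldl-++; ++-assoc; ++-identityʳ; map-∘; map-id; unfold-reverse; concat-++; reverse-++; reverse-map;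
         reverse-involutive; concatMap-++; concatMap-cong; map-concatMap; map-replicate; applyUpTo-∷ʳ; map-applyUpTo)
open import Data.List.Relation.Unary.All as All using (All; []; _∷_)
open import Data.List.Relation.Unary.Any using (here; there)
open import Data.List.Relation.Unary.Linked as Linked using (Linked; []; [-]; _∷_)
open import Data.List.Relation.Unary.Linked.Properties using (Linked⇒All)
open import Data.Maybe using (Maybe; just; nothing)
import Data.Maybe.Relation.Unary.All as Maybe
open import Data.Nat using (ℕ; zero; suc; _≤_; _<_; _<?_; _≤?_; _∸_; _+_; _≤ᵇ_; z≤n; s≤s)
open import Data.Nat.Properties
  using (≤-refl; ≤-reflexive; ≤-trans; <-trans; <⇒≤; ≤-<-trans; <-≤-trans; ≮⇒≥; ≰⇒>; ≤⇒≯; ≤ᵇ⇒≤; n≤1+n; m≤n+m;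
         m∸[m∸n]≡n; m≤n⇒m∸n≡0; m∸n≤m; m∸n+n≡m; +-∸-assoc; ∸-+-assoc; +-comm)
open import Data.Product using (Σ; ∃; _×_; _,_; proj₁; proj₂; map₁)
open import Data.Unit using (tt)
open import Function using (_∘_)
open import Relation.Binary.Construct.Closure.Equivalence using (gfold; gmap; setoid)
open import Relation.Binary.Construct.Closure.Reflexive using (ReflClosure; refl; [_]; reflexive)
open import Relation.Binary.Construct.Closure.ReflexiveTransitive using (ε; _◅_; _◅◅_)
open import Relation.Binary.Construct.Closure.Symmetric using (SymClosure; fwd; bwd)
open import Relation.Binary.PropositionalEquality
  using (_≡_; refl; sym; trans; cong; cong₂; subst; subst₂; isEquivalence; module ≡-Reasoning)
import Relation.Binary.Reasoning.Setoid as ≈-Reasoning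
open import Relation.Nullary using (¬_; yes; no)

-- Schensted row insertion

Sorted : List ℕ → Set
Sorted = Linked _≤_

head≤ : ∀ {r R} → Sorted (r ∷ R) → All (r ≤_) R
head≤ [-] = []
head≤ (r≤s ∷ s) = Linked⇒All ≤-trans r≤s s

rowInsert : ℕ → List ℕ → List ℕ × Maybe ℕ
rowInsert a [] = a ∷ [] , nothing
rowInsert a (r ∷ R) with a <? r
... | yes _ = a ∷ R , just r
... | no _ = map₁ (r ∷_) (rowInsert a R)

rowInsert-< : ∀ {a r R} → a < r → rowInsert a (r ∷ R) ≡ (a ∷ R , just r)
rowInsert-< {a} {r} a<r with a <? r
... | yes _ = refl
... | no a≮r = ⊥-elim (a≮r a<r)

rowInsert-≥ : ∀ {a r R} → r ≤ a → rowInsert a (r ∷ R) ≡ map₁ (r ∷_) (rowInsert a R)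
rowInsert-≥ {a} {r} r≤a with a <? r
... | yes a<r = ⊥-elim (≤⇒≯ r≤a a<r)
... | no _ = refl

rowInsert-All : ∀ {P : ℕ → Set} a R → All P R → P a → All P (proj₁ (rowInsert a R))
rowInsert-All a [] _ pa = pa ∷ []
rowInsert-All a (r ∷ R) (pr ∷ pR) pa with a <? r
... | yes _ = pa ∷ pR
... | no _ = pr ∷ rowInsert-All a R pR pa

sorted-∷ : ∀ {r R} → All (r ≤_) R → Sorted R → Sorted (r ∷ R)
sorted-∷ [] _ = [-]
sorted-∷ (r≤s ∷ _) s = r≤s ∷ s

rowInsert-sorted : ∀ a R → Sorted R → Sorted (proj₁ (rowInsert a R))
rowInsert-sorted a [] _ = [-]
rowInsert-sorted a (r ∷ R) s with a <? r
... | yes a<r = sorted-∷ (All.map (≤-trans (<⇒≤ a<r)) (head≤ s)) (Linked.tail s)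
... | no a≮r = sorted-∷ (rowInsert-All a R (head≤ s) (≮⇒≥ a≮r)) (rowInsert-sorted a R (Linked.tail s))

rowInsert-bumped-> : ∀ a R → Maybe.All (a <_) (proj₂ (rowInsert a R))
rowInsert-bumped-> a [] = Maybe.nothing
rowInsert-bumped-> a (r ∷ R) with a <? r
... | yes a<r = Maybe.just a<r
... | no _ = rowInsert-bumped-> a R

rowInsert-bumped-All : ∀ {P : ℕ → Set} a R → All P R → Maybe.All P (proj₂ (rowInsert a R))
rowInsert-bumped-All a [] _ = Maybe.nothing
rowInsert-bumped-All a (r ∷ R) (pr ∷ pR) with a <? r
... | yes _ = Maybe.just pr
... | no _ = rowInsert-bumped-All a R pR

rowInsert-nothing : ∀ a R → proj₂ (rowInsert a R) ≡ nothing → All (_≤ a) (proj₁ (rowInsert a R))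
rowInsert-nothing a [] _ = ≤-refl ∷ []
rowInsert-nothing a (r ∷ R) e with a <? r
... | no a≮r = ≮⇒≥ a≮r ∷ rowInsert-nothing a R e

rowInsert-≤ : ∀ a R → All (_≤ a) R → proj₂ (rowInsert a R) ≡ nothing
rowInsert-≤ a [] _ = refl
rowInsert-≤ a (r ∷ R) (r≤a ∷ R≤a) with a <? r
... | yes a<r = ⊥-elim (≤⇒≯ r≤a a<r)
... | no _ = rowInsert-≤ a R R≤a

rowInsert-head≤ : ∀ a R → ∃ λ h → ∃ λ t → proj₁ (rowInsert a R) ≡ h ∷ t × h ≤ a
rowInsert-head≤ a [] = a , [] , refl , ≤-refl
rowInsert-head≤ a (r ∷ R) with a <? r
... | yes _ = a , R , refl , ≤-refl
... | no a≮r = r , _ , refl , ≮⇒≥ a≮r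

rowInsert-∈ : ∀ a R → a ∈ proj₁ (rowInsert a R)
rowInsert-∈ a [] = here refl
rowInsert-∈ a (r ∷ R) with a <? r
... | yes _ = here refl
... | no _ = there (rowInsert-∈ a R)

rowInsert-bumped-≤ : ∀ {y c} R → Sorted R → c ∈ R → y < c →
  ∃ λ b → proj₂ (rowInsert y R) ≡ just b × b ≤ c
rowInsert-bumped-≤ {y} (s ∷ S) srt c∈R y<c with y <? s
... | yes _ = s , refl , head≤-∈ c∈R
  where
  head≤-∈ : ∀ {c} → c ∈ s ∷ S → s ≤ c
  head≤-∈ (here refl) = ≤-refl
  head≤-∈ (there c∈S) = All.lookup (head≤ srt) c∈S
rowInsert-bumped-≤ (s ∷ S) srt (here refl) y<c | no y≮s = ⊥-elim (y≮s y<c)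
rowInsert-bumped-≤ (s ∷ S) srt (there c∈S) y<c | no _ = rowInsert-bumped-≤ S (Linked.tail srt) c∈S y<c

just-All : ∀ {P : ℕ → Set} {mb b} → mb ≡ just b → Maybe.All P mb → P b
just-All refl (Maybe.just pb) = pb

rowInsert-bumped-mono : ∀ {y z by bz} R → Sorted R → y ≤ z →
  proj₂ (rowInsert y R) ≡ just by → proj₂ (rowInsert z (proj₁ (rowInsert y R))) ≡ just bz → by ≤ bz
rowInsert-bumped-mono {y} {z} (s ∷ R) srt y≤z e₁ e₂ with y <? s
... | yes _ with refl ← e₁ =
  just-All (trans (cong proj₂ (sym (rowInsert-≥ y≤z))) e₂) (rowInsert-bumped-All z R (head≤ srt))
... | no y≮s =
  rowInsert-bumped-mono R (Linked.tail srt) y≤z e₁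
    (trans (cong proj₂ (sym (rowInsert-≥ (≤-trans (≮⇒≥ y≮s) y≤z)))) e₂)

consMaybe : Maybe ℕ → List ℕ → List ℕ
consMaybe nothing w = w
consMaybe (just b) w = b ∷ w

rowInsertWord : List ℕ → List ℕ → List ℕ × List ℕ
rowInsertWord R [] = R , []
rowInsertWord R (a ∷ w) =
  let (R₁ , b) = rowInsert a R
      (R₂ , bs) = rowInsertWord R₁ w
  in R₂ , consMaybe b bs

rowInsertWord-∷ : ∀ {a R w R₁ b R₂ bs} → rowInsert a R ≡ (R₁ , b) → rowInsertWord R₁ w ≡ (R₂ , bs) →
  rowInsertWord R (a ∷ w) ≡ (R₂ , consMaybe b bs)
rowInsertWord-∷ refl refl = refl

rowInsertWord-3 : ∀ {a b c R R₁ R₂ R₃ m₁ m₂ m₃} →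
  rowInsert a R ≡ (R₁ , m₁) → rowInsert b R₁ ≡ (R₂ , m₂) → rowInsert c R₂ ≡ (R₃ , m₃) →
  rowInsertWord R (a ∷ b ∷ c ∷ []) ≡ (R₃ , consMaybe m₁ (consMaybe m₂ (consMaybe m₃ [])))
rowInsertWord-3 {a} {b} {c} {R} {R₁} {R₂} e₁ e₂ e₃ =
  rowInsertWord-∷ {R = R} {b ∷ c ∷ []} e₁
    (rowInsertWord-∷ {R = R₁} {c ∷ []} e₂ (rowInsertWord-∷ {R = R₂} {[]} e₃ refl))

rowInsert-≥′ : ∀ {a r R R₁ m} → r ≤ a → rowInsert a R ≡ (R₁ , m) → rowInsert a (r ∷ R) ≡ (r ∷ R₁ , m)
rowInsert-≥′ {r = r} r≤a e = trans (rowInsert-≥ r≤a) (cong (map₁ (r ∷_)) e)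

rowInsertWord-≥ : ∀ {r} R w → All (r ≤_) w → rowInsertWord (r ∷ R) w ≡ map₁ (r ∷_) (rowInsertWord R w)
rowInsertWord-≥ R [] _ = refl
rowInsertWord-≥ R (a ∷ w) (r≤a ∷ r≤w) =
  rowInsertWord-∷ (rowInsert-≥′ r≤a refl) (rowInsertWord-≥ (proj₁ (rowInsert a R)) w r≤w)

-- Row insertion and Knuth moves

data KnuthMove : List ℕ → List ℕ → Set where
  xzy↦zxy : ∀ {x y z} → x ≤ y → y < z → KnuthMove (x ∷ z ∷ y ∷ []) (z ∷ x ∷ y ∷ [])
  yxz↦yzx : ∀ {x y z} → x < y → y ≤ z → KnuthMove (y ∷ x ∷ z ∷ []) (y ∷ z ∷ x ∷ [])

AtMostOneMove : List ℕ → List ℕ → Set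
AtMostOneMove = ReflClosure (SymClosure KnuthMove)

record RowInsertionAgrees (R u v : List ℕ) : Set where
  constructor _,_
  field
    sameRow : proj₁ (rowInsertWord R u) ≡ proj₁ (rowInsertWord R v)
    bumpedMove : AtMostOneMove (proj₂ (rowInsertWord R u)) (proj₂ (rowInsertWord R v))

agrees : ∀ {R u v X bu bv} → rowInsertWord R u ≡ (X , bu) → rowInsertWord R v ≡ (X , bv) →
  AtMostOneMove bu bv → RowInsertionAgrees R u v
agrees eu ev m =
  trans (cong proj₁ eu) (sym (cong proj₁ ev)) , subst₂ AtMostOneMove (sym (cong proj₂ eu)) (sym (cong proj₂ ev)) m

agrees-≡ : ∀ {R u v} → rowInsertWord R u ≡ rowInsertWord R v → RowInsertionAgrees R u v
agrees-≡ e = cong proj₁ e , reflexive (cong proj₂ e)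

agrees-∷ : ∀ {r} R u v → All (r ≤_) u → All (r ≤_) v → RowInsertionAgrees R u v → RowInsertionAgrees (r ∷ R) u v
agrees-∷ {r} R u v r≤u r≤v (sameRow , m) =
  agrees (rowInsertWord-≥ R u r≤u)
    (trans (rowInsertWord-≥ R v r≤v) (cong (λ X → r ∷ X , proj₂ (rowInsertWord R v)) (sym sameRow))) m

rowInsertWord-[]-move : ∀ {u v} → KnuthMove u v → rowInsertWord [] u ≡ rowInsertWord [] v
rowInsertWord-[]-move (xzy↦zxy {x} {z = z} x≤y y<z) =
  trans (rowInsertWord-3 {a = x} {R = []} refl
           (rowInsert-≥′ (≤-trans x≤y (<⇒≤ y<z)) refl) (rowInsert-≥′ x≤y (rowInsert-< y<z)))
    (sym (rowInsertWord-3 {a = z} {R = []} refl (rowInsert-< (≤-<-trans x≤y y<z)) (rowInsert-≥′ x≤y refl)))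
rowInsertWord-[]-move (yxz↦yzx {y = y} x<y y≤z) =
  trans (rowInsertWord-3 {a = y} {R = []} refl (rowInsert-< x<y) (rowInsert-≥′ (≤-trans (<⇒≤ x<y) y≤z) refl))
    (sym (rowInsertWord-3 {a = y} {R = []} refl (rowInsert-≥′ y≤z refl) (rowInsert-< x<y)))

module _ {x y z : ℕ} (x≤y : x ≤ y) (y<z : y < z) where

  private
    x≤z : x ≤ z
    x≤z = ≤-trans x≤y (<⇒≤ y<z)
    x<z : x < z
    x<z = ≤-<-trans x≤y y<z

  xzy-agrees-middle : ∀ {r} R → Sorted (r ∷ R) → x < r → r ≤ z →
    RowInsertionAgrees (r ∷ R) (x ∷ z ∷ y ∷ []) (z ∷ x ∷ y ∷ [])
  xzy-agrees-middle {r} R s x<r r≤z with rowInsert z R in eq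
  ... | R₁ , nothing =
    agrees (rowInsertWord-3 (rowInsert-< x<r) (rowInsert-≥′ x≤z eq) (rowInsert-≥′ x≤y refl))
           (rowInsertWord-3 (rowInsert-≥′ r≤z eq) (rowInsert-< x<r) (rowInsert-≥′ x≤y refl)) refl
  ... | R₁ , just bz = agrees
    (rowInsertWord-3 (rowInsert-< x<r) (rowInsert-≥′ x≤z eq) (rowInsert-≥′ x≤y eby))
    (rowInsertWord-3 (rowInsert-≥′ r≤z eq) (rowInsert-< x<r) (rowInsert-≥′ x≤y eby))
    [ fwd (xzy↦zxy r≤by (≤-<-trans by≤z z<bz)) ]
    where
    bumped : ∃ λ b → proj₂ (rowInsert y R₁) ≡ just b × b ≤ z
    bumped = rowInsert-bumped-≤ R₁ (subst Sorted (cong proj₁ eq) (rowInsert-sorted z R (Linked.tail s)))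
               (subst (z ∈_) (cong proj₁ eq) (rowInsert-∈ z R)) y<z
    by : ℕ
    by = proj₁ bumped
    eby : rowInsert y R₁ ≡ (proj₁ (rowInsert y R₁) , just by)
    eby = cong (proj₁ (rowInsert y R₁) ,_) (proj₁ (proj₂ bumped))
    by≤z : by ≤ z
    by≤z = proj₂ (proj₂ bumped)
    z<bz : z < bz
    z<bz = just-All (cong proj₂ eq) (rowInsert-bumped-> z R)
    r≤by : r ≤ by
    r≤by = just-All (proj₁ (proj₂ bumped))
             (rowInsert-bumped-All y R₁ (subst (All (r ≤_)) (cong proj₁ eq) (rowInsert-All z R (head≤ s) r≤z)))

  xzy-agrees-large : ∀ {r} R → Sorted (r ∷ R) → z < r →
    RowInsertionAgrees (r ∷ R) (x ∷ z ∷ y ∷ []) (z ∷ x ∷ y ∷ [])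
  xzy-agrees-large {r} [] _ z<r = agrees
    (rowInsertWord-3 (rowInsert-< x<r) (rowInsert-≥′ x≤z refl) (rowInsert-≥′ x≤y (rowInsert-< y<z)))
    (rowInsertWord-3 (rowInsert-< z<r) (rowInsert-< x<z) (rowInsert-≥′ x≤y refl)) refl
    where
    x<r : x < r
    x<r = <-trans x<z z<r
  xzy-agrees-large {r} (t ∷ R) (r≤t ∷ _) z<r = agrees
    (rowInsertWord-3 (rowInsert-< x<r) (rowInsert-≥′ x≤z (rowInsert-< z<t)) (rowInsert-≥′ x≤y (rowInsert-< y<z)))
    (rowInsertWord-3 (rowInsert-< z<r) (rowInsert-< x<z) (rowInsert-≥′ x≤y (rowInsert-< (<-trans y<z z<t))))
    [ bwd (yxz↦yzx z<r r≤t) ]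
    where
    x<r : x < r
    x<r = <-trans x<z z<r
    z<t : z < t
    z<t = <-≤-trans z<r r≤t

  xzy-agrees : ∀ R → Sorted R → RowInsertionAgrees R (x ∷ z ∷ y ∷ []) (z ∷ x ∷ y ∷ [])
  xzy-agrees [] _ = agrees-≡ (rowInsertWord-[]-move (xzy↦zxy x≤y y<z))
  xzy-agrees (r ∷ R) s with r ≤? x | r ≤? z
  ... | yes r≤x | _ = agrees-∷ R _ _ (r≤x ∷ r≤z ∷ r≤y ∷ []) (r≤z ∷ r≤x ∷ r≤y ∷ []) (xzy-agrees R (Linked.tail s))
    where
    r≤y : r ≤ y
    r≤y = ≤-trans r≤x x≤y
    r≤z : r ≤ z
    r≤z = ≤-trans r≤x x≤z
  ... | no r≰x | yes r≤z = xzy-agrees-middle R s (≰⇒> r≰x) r≤z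
  ... | no _ | no r≰z = xzy-agrees-large R s (≰⇒> r≰z)

module _ {x y z : ℕ} (x<y : x < y) (y≤z : y ≤ z) where

  private
    x≤z : x ≤ z
    x≤z = ≤-trans (<⇒≤ x<y) y≤z

  yxz-agrees-middle : ∀ {r} R → Sorted (r ∷ R) → x < r → r ≤ y →
    RowInsertionAgrees (r ∷ R) (y ∷ x ∷ z ∷ []) (y ∷ z ∷ x ∷ [])
  yxz-agrees-middle {r} R s x<r r≤y with rowInsert y R in eq
  ... | R₁ , nothing = agrees
    (rowInsertWord-3 (rowInsert-≥′ r≤y eq) (rowInsert-< x<r) (rowInsert-≥′ x≤z ez))
    (rowInsertWord-3 (rowInsert-≥′ r≤y eq) (rowInsert-≥′ r≤z ez) (rowInsert-< x<r)) refl
    where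
    r≤z : r ≤ z
    r≤z = ≤-trans r≤y y≤z
    R₁≤y : All (_≤ y) R₁
    R₁≤y = subst (All (_≤ y)) (cong proj₁ eq) (rowInsert-nothing y R (cong proj₂ eq))
    ez : rowInsert z R₁ ≡ (proj₁ (rowInsert z R₁) , nothing)
    ez = cong (proj₁ (rowInsert z R₁) ,_) (rowInsert-≤ z R₁ (All.map (λ t≤y → ≤-trans t≤y y≤z) R₁≤y))
  ... | R₁ , just by with rowInsert z R₁ in eq′
  ...   | R₂ , nothing = agrees
    (rowInsertWord-3 (rowInsert-≥′ r≤y eq) (rowInsert-< x<r) (rowInsert-≥′ x≤z eq′))
    (rowInsertWord-3 (rowInsert-≥′ r≤y eq) (rowInsert-≥′ (≤-trans r≤y y≤z) eq′) (rowInsert-< x<r)) refl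
  ...   | R₂ , just bz = agrees
    (rowInsertWord-3 (rowInsert-≥′ r≤y eq) (rowInsert-< x<r) (rowInsert-≥′ x≤z eq′))
    (rowInsertWord-3 (rowInsert-≥′ r≤y eq) (rowInsert-≥′ (≤-trans r≤y y≤z) eq′) (rowInsert-< x<r))
    [ fwd (yxz↦yzx r<by by≤bz) ]
    where
    r<by : r < by
    r<by = ≤-<-trans r≤y (just-All (cong proj₂ eq) (rowInsert-bumped-> y R))
    by≤bz : by ≤ bz
    by≤bz = rowInsert-bumped-mono R (Linked.tail s) y≤z (cong proj₂ eq)
              (trans (cong (λ S → proj₂ (rowInsert z S)) (cong proj₁ eq)) (cong proj₂ eq′))

  yxz-agrees-large : ∀ {r} R → Sorted (r ∷ R) → y < r →
    RowInsertionAgrees (r ∷ R) (y ∷ x ∷ z ∷ []) (y ∷ z ∷ x ∷ [])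
  yxz-agrees-large R s y<r with rowInsert z R in eq
  ... | R₃ , nothing = agrees
    (rowInsertWord-3 (rowInsert-< y<r) (rowInsert-< x<y) (rowInsert-≥′ x≤z eq))
    (rowInsertWord-3 (rowInsert-< y<r) (rowInsert-≥′ y≤z eq) (rowInsert-< x<y)) refl
  ... | R₃ , just bz = agrees
    (rowInsertWord-3 (rowInsert-< y<r) (rowInsert-< x<y) (rowInsert-≥′ x≤z eq))
    (rowInsertWord-3 (rowInsert-< y<r) (rowInsert-≥′ y≤z eq) (rowInsert-< x<y))
    [ fwd (yxz↦yzx y<r (just-All (cong proj₂ eq) (rowInsert-bumped-All z R (head≤ s)))) ]

  yxz-agrees : ∀ R → Sorted R → RowInsertionAgrees R (y ∷ x ∷ z ∷ []) (y ∷ z ∷ x ∷ [])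
  yxz-agrees [] _ = agrees-≡ (rowInsertWord-[]-move (yxz↦yzx x<y y≤z))
  yxz-agrees (r ∷ R) s with r ≤? x | r ≤? y
  ... | yes r≤x | _ = agrees-∷ R _ _ (r≤y ∷ r≤x ∷ r≤z ∷ []) (r≤y ∷ r≤z ∷ r≤x ∷ []) (yxz-agrees R (Linked.tail s))
    where
    r≤y : r ≤ y
    r≤y = ≤-trans r≤x (<⇒≤ x<y)
    r≤z : r ≤ z
    r≤z = ≤-trans r≤x x≤z
  ... | no r≰x | yes r≤y = yxz-agrees-middle R s (≰⇒> r≰x) r≤y
  ... | no _ | no r≰y = yxz-agrees-large R s (≰⇒> r≰y)

rowInsertWord-move : ∀ {R u v} → Sorted R → KnuthMove u v → RowInsertionAgrees R u v
rowInsertWord-move s (xzy↦zxy x≤y y<z) = xzy-agrees x≤y y<z _ s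
rowInsertWord-move s (yxz↦yzx x<y y≤z) = yxz-agrees x<y y≤z _ s

-- The insertion tableau

mutual
  insert : ℕ → Tableau → Tableau
  insert a [] = (a ∷ []) ∷ []
  insert a (R ∷ T) = proj₁ (rowInsert a R) ∷ insertMaybe (proj₂ (rowInsert a R)) T

  insertMaybe : Maybe ℕ → Tableau → Tableau
  insertMaybe nothing T = T
  insertMaybe (just b) T = insert b T

insertWord : Tableau → List ℕ → Tableau
insertWord = foldl (λ T a → insert a T)

insertionTableau : List ℕ → Tableau
insertionTableau = insertWord []

insertWord-++ : ∀ T u w → insertWord T (u ++ w) ≡ insertWord (insertWord T u) w
insertWord-++ = foldl-++ (λ T a → insert a T)

insertWord-consMaybe : ∀ b T w → insertWord T (consMaybe b w) ≡ insertWord (insertMaybe b T) w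
insertWord-consMaybe nothing T w = refl
insertWord-consMaybe (just b) T w = refl

insertWord-∷ : ∀ R T w → insertWord (R ∷ T) w ≡ proj₁ (rowInsertWord R w) ∷ insertWord T (proj₂ (rowInsertWord R w))
insertWord-∷ R T [] = refl
insertWord-∷ R T (a ∷ w) =
  trans (insertWord-∷ R₁ (insertMaybe b T) w)
        (cong (proj₁ (rowInsertWord R₁ w) ∷_) (sym (insertWord-consMaybe b T (proj₂ (rowInsertWord R₁ w)))))
  where
  R₁ : List ℕ
  R₁ = proj₁ (rowInsert a R)
  b : Maybe ℕ
  b = proj₂ (rowInsert a R)

mutual
  insert-sorted : ∀ a T → All Sorted T → All Sorted (insert a T)
  insert-sorted a [] [] = [-] ∷ []
  insert-sorted a (R ∷ T) (s ∷ ss) = rowInsert-sorted a R s ∷ insertMaybe-sorted (proj₂ (rowInsert a R)) T ss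

  insertMaybe-sorted : ∀ b T → All Sorted T → All Sorted (insertMaybe b T)
  insertMaybe-sorted nothing T ss = ss
  insertMaybe-sorted (just b) T ss = insert-sorted b T ss

insertWord-sorted : ∀ T w → All Sorted T → All Sorted (insertWord T w)
insertWord-sorted T [] ss = ss
insertWord-sorted T (a ∷ w) ss = insertWord-sorted (insert a T) w (insert-sorted a T ss)

-- On nonempty words the empty tableau behaves as the tableau with one empty row.
insertWord-[]-move : ∀ {u v} → KnuthMove u v → insertWord [] u ≡ insertWord [] v
insertWord-[]-move {[]} ()
insertWord-[]-move {_ ∷ _} {[]} ()
insertWord-[]-move {u@(_ ∷ _)} {v@(_ ∷ _)} m =
  trans (insertWord-∷ [] [] u)
    (trans (cong (λ q → proj₁ q ∷ insertWord [] (proj₂ q)) (rowInsertWord-[]-move m))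
           (sym (insertWord-∷ [] [] v)))

mutual
  insertWord-move : ∀ T → All Sorted T → ∀ {u v} → KnuthMove u v → insertWord T u ≡ insertWord T v
  insertWord-move [] [] m = insertWord-[]-move m
  insertWord-move (R ∷ T) (s ∷ ss) {u} {v} m =
    trans (insertWord-∷ R T u)
      (trans (cong₂ _∷_ sameRow (insertWord-moves T ss bumpedMove)) (sym (insertWord-∷ R T v)))
    where open RowInsertionAgrees (rowInsertWord-move s m)

  insertWord-moves : ∀ T → All Sorted T → ∀ {u v} → AtMostOneMove u v → insertWord T u ≡ insertWord T v
  insertWord-moves T ss refl = refl
  insertWord-moves T ss [ fwd m ] = insertWord-move T ss m
  insertWord-moves T ss [ bwd m ] = sym (insertWord-move T ss m)

insertWord-move-inside : ∀ T → All Sorted T → ∀ u v {a b} → KnuthMove a b →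
  insertWord T (u ++ a ++ v) ≡ insertWord T (u ++ b ++ v)
insertWord-move-inside T ss u v {a} {b} m = begin
  insertWord T (u ++ a ++ v)                   ≡⟨ insertWord-++ T u (a ++ v) ⟩
  insertWord (insertWord T u) (a ++ v)         ≡⟨ insertWord-++ (insertWord T u) a v ⟩
  insertWord (insertWord (insertWord T u) a) v ≡⟨ cong (λ T′ → insertWord T′ v) (insertWord-move _ sorted m) ⟩
  insertWord (insertWord (insertWord T u) b) v ≡⟨ insertWord-++ (insertWord T u) b v ⟨
  insertWord (insertWord T u) (b ++ v)         ≡⟨ insertWord-++ T u (b ++ v) ⟨
  insertWord T (u ++ b ++ v)                   ∎
  where
  open ≡-Reasoning
  sorted : All Sorted (insertWord T u)
  sorted = insertWord-sorted T u ss

insertionTableau-KnuthStep : ∀ {w w′} → KnuthStep w w′ → insertionTableau w ≡ insertionTableau w′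
insertionTableau-KnuthStep (k1 u v x y z x≤y y<z) = insertWord-move-inside [] [] u v (xzy↦zxy x≤y y<z)
insertionTableau-KnuthStep (k2 u v x y z x<y y≤z) = insertWord-move-inside [] [] u v (yxz↦yzx x<y y≤z)

insertionTableau-KnuthEquiv : ∀ {w w′} → KnuthEquiv w w′ → insertionTableau w ≡ insertionTableau w′
insertionTableau-KnuthEquiv = gfold isEquivalence insertionTableau insertionTableau-KnuthStep

KnuthEquiv-reflexive : ∀ {u v} → u ≡ v → KnuthEquiv u v
KnuthEquiv-reflexive refl = ε

module KnuthReasoning = ≈-Reasoning (setoid KnuthStep)

KnuthEquiv-++ˡ : ∀ p {u v} → KnuthEquiv u v → KnuthEquiv (p ++ u) (p ++ v)
KnuthEquiv-++ˡ p = gmap (p ++_) step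
  where
  step : ∀ {u v} → KnuthStep u v → KnuthStep (p ++ u) (p ++ v)
  step (k1 u v x y z h₁ h₂) = subst₂ KnuthStep (++-assoc p u _) (++-assoc p u _) (k1 (p ++ u) v x y z h₁ h₂)
  step (k2 u v x y z h₁ h₂) = subst₂ KnuthStep (++-assoc p u _) (++-assoc p u _) (k2 (p ++ u) v x y z h₁ h₂)

KnuthEquiv-++ʳ : ∀ q {u v} → KnuthEquiv u v → KnuthEquiv (u ++ q) (v ++ q)
KnuthEquiv-++ʳ q = gmap (_++ q) step
  where
  step : ∀ {u v} → KnuthStep u v → KnuthStep (u ++ q) (v ++ q)
  step (k1 u v x y z h₁ h₂) =
    subst₂ KnuthStep (sym (++-assoc u _ q)) (sym (++-assoc u _ q)) (k1 u (v ++ q) x y z h₁ h₂)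
  step (k2 u v x y z h₁ h₂) =
    subst₂ KnuthStep (sym (++-assoc u _ q)) (sym (++-assoc u _ q)) (k2 u (v ++ q) x y z h₁ h₂)

sorted-++-smaller : ∀ {a r} R → a < r → Sorted (r ∷ R) → KnuthEquiv ((r ∷ R) ++ a ∷ []) (r ∷ a ∷ R)
sorted-++-smaller [] a<r s = ε
sorted-++-smaller {a} {r} (t ∷ R) a<r (r≤t ∷ s) =
  KnuthEquiv-++ˡ (r ∷ []) (sorted-++-smaller R (<-≤-trans a<r r≤t) s) ◅◅ bwd (k2 [] R a r t a<r r≤t) ◅ ε

rowInsert-KnuthEquiv : ∀ a R → Sorted R →
  KnuthEquiv (R ++ a ∷ []) (consMaybe (proj₂ (rowInsert a R)) (proj₁ (rowInsert a R)))
rowInsert-KnuthEquiv a [] _ = ε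
rowInsert-KnuthEquiv a (r ∷ R) s with a <? r
... | yes a<r = sorted-++-smaller R a<r s
... | no a≮r with rowInsert a R | rowInsert-KnuthEquiv a R (Linked.tail s) | rowInsert-head≤ a R
                | rowInsert-All a R (head≤ s) (≮⇒≥ a≮r) | rowInsert-bumped-> a R
...   | R₁ , nothing | ih | _ | _ | _ = KnuthEquiv-++ˡ (r ∷ []) ih
...   | R₁ , just b | ih | h , t , refl , h≤a | r≤h ∷ _ | Maybe.just a<b =
  KnuthEquiv-++ˡ (r ∷ []) ih ◅◅ fwd (k1 [] t r h b r≤h (≤-<-trans h≤a a<b)) ◅ ε

tableauWord : Tableau → List ℕ
tableauWord [] = []
tableauWord (R ∷ T) = tableauWord T ++ R

insert-KnuthEquiv : ∀ a T → All Sorted T → KnuthEquiv (tableauWord T ++ a ∷ []) (tableauWord (insert a T))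
insert-KnuthEquiv a [] _ = ε
insert-KnuthEquiv a (R ∷ T) (s ∷ ss) with rowInsert a R | rowInsert-KnuthEquiv a R s
... | R₁ , nothing | k = begin
  (tableauWord T ++ R) ++ a ∷ []  ≡⟨ ++-assoc (tableauWord T) R _ ⟩
  tableauWord T ++ R ++ a ∷ []    ≈⟨ KnuthEquiv-++ˡ (tableauWord T) k ⟩
  tableauWord T ++ R₁             ∎
  where open KnuthReasoning
... | R₁ , just b | k = begin
  (tableauWord T ++ R) ++ a ∷ []  ≡⟨ ++-assoc (tableauWord T) R _ ⟩
  tableauWord T ++ R ++ a ∷ []    ≈⟨ KnuthEquiv-++ˡ (tableauWord T) k ⟩
  tableauWord T ++ b ∷ R₁         ≡⟨ ++-assoc (tableauWord T) (b ∷ []) R₁ ⟨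
  (tableauWord T ++ b ∷ []) ++ R₁ ≈⟨ KnuthEquiv-++ʳ R₁ (insert-KnuthEquiv b T ss) ⟩
  tableauWord (insert b T) ++ R₁  ∎
  where open KnuthReasoning

insertWord-KnuthEquiv : ∀ T w → All Sorted T → KnuthEquiv (tableauWord T ++ w) (tableauWord (insertWord T w))
insertWord-KnuthEquiv T [] _ = KnuthEquiv-reflexive (++-identityʳ (tableauWord T))
insertWord-KnuthEquiv T (a ∷ w) ss = begin
  tableauWord T ++ a ∷ w              ≡⟨ ++-assoc (tableauWord T) (a ∷ []) w ⟨
  (tableauWord T ++ a ∷ []) ++ w      ≈⟨ KnuthEquiv-++ʳ w (insert-KnuthEquiv a T ss) ⟩
  tableauWord (insert a T) ++ w       ≈⟨ insertWord-KnuthEquiv (insert a T) w (insert-sorted a T ss) ⟩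
  tableauWord (insertWord T (a ∷ w)) ∎
  where open KnuthReasoning

KnuthEquiv-insertionTableau : ∀ w → KnuthEquiv w (tableauWord (insertionTableau w))
KnuthEquiv-insertionTableau w = insertWord-KnuthEquiv [] w []

rowInsert-ColStrict-above : ∀ a R S → ColStrict R S → ColStrict (proj₁ (rowInsert a R)) S
rowInsert-ColStrict-above a [] [] _ = tt
rowInsert-ColStrict-above a (r ∷ R) [] _ = tt
rowInsert-ColStrict-above a (r ∷ R) (s ∷ S) (r<s , c) with a <? r
... | yes a<r = <-trans a<r r<s , c
... | no _ = r<s , rowInsert-ColStrict-above a R S c

rowInsertMaybe : Maybe ℕ → List ℕ → List ℕ
rowInsertMaybe nothing S = S
rowInsertMaybe (just b) S = proj₁ (rowInsert b S)

-- A bumped letter lands weakly left of its old column in the next row.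
rowInsert-ColStrict : ∀ a R S → Sorted R → ColStrict R S →
  ColStrict (proj₁ (rowInsert a R)) (rowInsertMaybe (proj₂ (rowInsert a R)) S)
rowInsert-ColStrict a [] [] _ _ = tt
rowInsert-ColStrict a (r ∷ R) S s c with a <? r
rowInsert-ColStrict a (r ∷ R) [] s c | yes a<r = a<r , tt
rowInsert-ColStrict a (r ∷ R) (t ∷ S) s (r<t , c) | yes a<r =
  subst (ColStrict (a ∷ R)) (sym (cong proj₁ (rowInsert-< {R = S} r<t))) (a<r , c)
rowInsert-ColStrict a (r ∷ R) [] s c | no a≮r with rowInsert a R | rowInsert-bumped-> a R
... | R₁ , nothing | _ = tt
... | R₁ , just b | Maybe.just a<b = ≤-<-trans (≮⇒≥ a≮r) a<b , tt
rowInsert-ColStrict a (r ∷ R) (t ∷ S) s (r<t , c) | no a≮r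
  with rowInsert a R | rowInsert-bumped-> a R | rowInsert-ColStrict a R S (Linked.tail s) c
     | rowInsert-ColStrict-above a R S c
... | R₁ , nothing | _ | ih | _ = r<t , ih
... | R₁ , just b | Maybe.just a<b | ih | above with b <? t
...   | yes _ = ≤-<-trans (≮⇒≥ a≮r) a<b , above
...   | no _ = r<t , ih

insert-ColStrict : ∀ a T → All Sorted T → Linked ColStrict T → Linked ColStrict (insert a T)
insert-ColStrict a [] _ _ = [-]
insert-ColStrict a (R ∷ []) (s ∷ _) _ with rowInsert a R | rowInsert-ColStrict a R [] s tt
... | _ , nothing | _ = [-]
... | _ , just _ | c = c ∷ [-]
insert-ColStrict a (R ∷ R′ ∷ T) (s ∷ ss) (c ∷ cs) with rowInsert a R | rowInsert-ColStrict a R R′ s c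
... | _ , nothing | c′ = c′ ∷ cs
... | _ , just b | c′ = c′ ∷ insert-ColStrict b (R′ ∷ T) ss cs

NonEmpty : List ℕ → Set
NonEmpty R = ¬ R ≡ []

insert-NonEmpty : ∀ a T → All NonEmpty T → All NonEmpty (insert a T)
insert-NonEmpty a [] _ = (λ ()) ∷ []
insert-NonEmpty a (R ∷ T) (_ ∷ ne) with rowInsert a R | rowInsert-head≤ a R
... | R₁ , nothing | _ , _ , refl , _ = (λ ()) ∷ ne
... | R₁ , just b | _ , _ , refl , _ = (λ ()) ∷ insert-NonEmpty b T ne

insert-SSYT : ∀ a T → IsSSYT T → IsSSYT (insert a T)
insert-SSYT a T (ne , ss , cs) = insert-NonEmpty a T ne , insert-sorted a T ss , insert-ColStrict a T ss cs

insertWord-SSYT : ∀ T w → IsSSYT T → IsSSYT (insertWord T w)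
insertWord-SSYT T [] t = t
insertWord-SSYT T (a ∷ w) t = insertWord-SSYT (insert a T) w (insert-SSYT a T t)

insertionTableau-SSYT : ∀ w → IsSSYT (insertionTableau w)
insertionTableau-SSYT w = insertWord-SSYT [] w ([] , [] , [])

rowInsertWord-ColStrict : ∀ w S → Sorted w → ColStrict w S → rowInsertWord S w ≡ (w , S)
rowInsertWord-ColStrict [] [] _ _ = refl
rowInsertWord-ColStrict (a ∷ w) [] s _ =
  rowInsertWord-∷ {R = []} refl
    (trans (rowInsertWord-≥ [] w (head≤ s))
           (cong (map₁ (a ∷_)) (rowInsertWord-ColStrict w [] (Linked.tail s) tt)))
rowInsertWord-ColStrict (a ∷ w) (t ∷ S) s (a<t , c) =
  rowInsertWord-∷ (rowInsert-< a<t)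
    (trans (rowInsertWord-≥ S w (head≤ s))
           (cong (map₁ (a ∷_)) (rowInsertWord-ColStrict w S (Linked.tail s) c)))

insertWord-SSYT-row : ∀ R Y → IsSSYT (R ∷ Y) → insertWord Y R ≡ R ∷ Y
insertWord-SSYT-row [] Y (ne ∷ _ , _) = ⊥-elim (ne refl)
insertWord-SSYT-row (a ∷ w) [] (_ , s ∷ _ , _) =
  trans (insertWord-∷ [] [] (a ∷ w))
        (cong (λ q → proj₁ q ∷ insertWord [] (proj₂ q)) (rowInsertWord-ColStrict (a ∷ w) [] s tt))
insertWord-SSYT-row R (R′ ∷ Y) (_ ∷ ne , s ∷ ss , c ∷ cs) =
  trans (insertWord-∷ R′ Y R)
    (trans (cong (λ q → proj₁ q ∷ insertWord Y (proj₂ q)) (rowInsertWord-ColStrict R R′ s c))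
           (cong (R ∷_) (insertWord-SSYT-row R′ Y (ne , ss , cs))))

insertionTableau-tableauWord : ∀ Y → IsSSYT Y → insertionTableau (tableauWord Y) ≡ Y
insertionTableau-tableauWord [] _ = refl
insertionTableau-tableauWord (R ∷ Y) t@(_ ∷ ne , _ ∷ ss , cs) = begin
  insertWord [] (tableauWord Y ++ R)
    ≡⟨ insertWord-++ [] (tableauWord Y) R ⟩
  insertWord (insertionTableau (tableauWord Y)) R
    ≡⟨ cong (λ T → insertWord T R) (insertionTableau-tableauWord Y (ne , ss , Linked.tail cs)) ⟩
  insertWord Y R
    ≡⟨ insertWord-SSYT-row R Y t ⟩
  R ∷ Y
    ∎
  where open ≡-Reasoning

-- Rectification

readingWord-asSkew : ∀ Y → readingWord (asSkew Y) ≡ tableauWord Y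
readingWord-asSkew Y = trans (cong (concat ∘ reverse) (trans (sym (map-∘ Y)) (map-id Y))) (concat-reverse Y)
  where
  concat-reverse : ∀ Y → concat (reverse Y) ≡ tableauWord Y
  concat-reverse [] = refl
  concat-reverse (R ∷ Y) = begin
    concat (reverse (R ∷ Y))       ≡⟨ cong concat (unfold-reverse R Y) ⟩
    concat (reverse Y ++ R ∷ [])   ≡⟨ concat-++ (reverse Y) (R ∷ []) ⟨
    concat (reverse Y) ++ R ++ []  ≡⟨ cong₂ _++_ (concat-reverse Y) (++-identityʳ R) ⟩
    tableauWord Y ++ R             ∎
    where open ≡-Reasoning

IsRect-insertionTableau : ∀ X → IsRect X (insertionTableau (readingWord X))
IsRect-insertionTableau X =
  insertionTableau-SSYT w ,
  subst (KnuthEquiv w) (sym (readingWord-asSkew (insertionTableau w))) (KnuthEquiv-insertionTableau w)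
  where
  w : List ℕ
  w = readingWord X

IsRect⇒≡insertionTableau : ∀ X {Y} → IsRect X Y → Y ≡ insertionTableau (readingWord X)
IsRect⇒≡insertionTableau X {Y} (ssyt , k) = begin
  Y                                               ≡⟨ insertionTableau-tableauWord Y ssyt ⟨
  insertionTableau (tableauWord Y)                ≡⟨ cong insertionTableau (readingWord-asSkew Y) ⟨
  insertionTableau (readingWord (asSkew Y))       ≡⟨ insertionTableau-KnuthEquiv k ⟨
  insertionTableau (readingWord X)                ∎
  where open ≡-Reasoning

IsRect-readingWord : ∀ X X′ {Y} → readingWord X ≡ readingWord X′ → IsRect X Y → IsRect X′ Y
IsRect-readingWord _ _ e (ssyt , k) = ssyt , subst (λ w → KnuthEquiv w _) e k

-- The reading words of T(P) and C(P)

[o∸m]∸[o∸n]≡n∸m : ∀ o m n → n ≤ o → (o ∸ m) ∸ (o ∸ n) ≡ n ∸ m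
[o∸m]∸[o∸n]≡n∸m o zero n n≤o = m∸[m∸n]≡n n≤o
[o∸m]∸[o∸n]≡n∸m o (suc m) zero _ = m≤n⇒m∸n≡0 (m∸n≤m o (suc m))
[o∸m]∸[o∸n]≡n∸m (suc o) (suc m) (suc n) (s≤s n≤o) = [o∸m]∸[o∸n]≡n∸m o m n n≤o

1+m∸[m∸n]≡1+n : ∀ {m n} → n ≤ m → suc m ∸ (m ∸ n) ≡ suc n
1+m∸[m∸n]≡1+n {m} {n} n≤m = trans (+-∸-assoc 1 (m∸n≤m m n)) (cong suc (m∸[m∸n]≡n n≤m))

[m∸n]∸1≡m∸[1+n] : ∀ m n → (m ∸ n) ∸ 1 ≡ m ∸ suc n
[m∸n]∸1≡m∸[1+n] m n = trans (∸-+-assoc m n 1) (cong (m ∸_) (+-comm n 1))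

applyUpTo-cong : ∀ {A : Set} (f g : ℕ → A) n → (∀ i → i < n → f i ≡ g i) → applyUpTo f n ≡ applyUpTo g n
applyUpTo-cong f g zero _ = refl
applyUpTo-cong f g (suc n) f≗g =
  cong₂ _∷_ (f≗g 0 (s≤s z≤n)) (applyUpTo-cong (f ∘ suc) (g ∘ suc) n (λ i i<n → f≗g (suc i) (s≤s i<n)))

reverse-range1 : ∀ m → reverse (range1 m) ≡ applyUpTo (m ∸_) m
reverse-range1 zero = refl
reverse-range1 (suc m) = begin
  reverse (range1 (suc m))            ≡⟨ cong reverse (applyUpTo-∷ʳ suc m) ⟨
  reverse (range1 m ++ suc m ∷ [])    ≡⟨ reverse-++ (range1 m) (suc m ∷ []) ⟩
  suc m ∷ reverse (range1 m)          ≡⟨ cong (suc m ∷_) (reverse-range1 m) ⟩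
  applyUpTo (suc m ∸_) (suc m)        ∎
  where open ≡-Reasoning

reverse-replicate : ∀ {A : Set} n (x : A) → reverse (replicate n x) ≡ replicate n x
reverse-replicate zero x = refl
reverse-replicate (suc n) x = begin
  reverse (x ∷ replicate n x)    ≡⟨ unfold-reverse x (replicate n x) ⟩
  reverse (replicate n x) ∷ʳ x   ≡⟨ cong (_∷ʳ x) (reverse-replicate n x) ⟩
  replicate n x ∷ʳ x             ≡⟨ replicate-∷ʳ n ⟩
  x ∷ replicate n x              ∎
  where
  open ≡-Reasoning
  replicate-∷ʳ : ∀ n → replicate n x ∷ʳ x ≡ x ∷ replicate n x
  replicate-∷ʳ zero = refl
  replicate-∷ʳ (suc n) = cong (x ∷_) (replicate-∷ʳ n)

reverse-concatMap : ∀ {A B : Set} (g : A → List B) xs →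
  reverse (concatMap g xs) ≡ concatMap (reverse ∘ g) (reverse xs)
reverse-concatMap g [] = refl
reverse-concatMap g (x ∷ xs) = begin
  reverse (g x ++ concatMap g xs)               ≡⟨ reverse-++ (g x) (concatMap g xs) ⟩
  reverse (concatMap g xs) ++ reverse (g x)     ≡⟨ cong (_++ reverse (g x)) (reverse-concatMap g xs) ⟩
  concatMap g′ (reverse xs) ++ reverse (g x)    ≡⟨ cong (concatMap g′ (reverse xs) ++_) (++-identityʳ (reverse (g x))) ⟨
  concatMap g′ (reverse xs) ++ g′ x ++ []       ≡⟨ concatMap-++ g′ (reverse xs) (x ∷ []) ⟨
  concatMap g′ (reverse xs ++ x ∷ [])           ≡⟨ cong (concatMap g′) (unfold-reverse x xs) ⟨
  concatMap g′ (reverse (x ∷ xs))               ∎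
  where
  open ≡-Reasoning
  g′ = reverse ∘ g

reverse-map-concatMap-replicate : ∀ (f d : ℕ → ℕ) xs →
  reverse (map f (concatMap (λ i → replicate (d i) i) xs)) ≡ concatMap (λ i → replicate (d i) (f i)) (reverse xs)
reverse-map-concatMap-replicate f d xs = begin
  reverse (map f (concatMap (λ i → replicate (d i) i) xs))           ≡⟨ cong reverse (map-concatMap f _ xs) ⟩
  reverse (concatMap (λ i → map f (replicate (d i) i)) xs)           ≡⟨ reverse-concatMap _ xs ⟩
  concatMap (λ i → reverse (map f (replicate (d i) i))) (reverse xs) ≡⟨ concatMap-cong reverse-block (reverse xs) ⟩
  concatMap (λ i → replicate (d i) (f i)) (reverse xs)               ∎
  where
  open ≡-Reasoning
  reverse-block : ∀ i → reverse (map f (replicate (d i) i)) ≡ replicate (d i) (f i)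
  reverse-block i = trans (cong reverse (map-replicate f (d i) i)) (reverse-replicate (d i) (f i))

readingWord-rotateComplement : ∀ m t → readingWord (rotateComplement m t) ≡ concatMap (reverse ∘ map (suc m ∸_)) t
readingWord-rotateComplement m t = begin
  concat (reverse (map proj₂ (reverse (map f t))))  ≡⟨ cong (concat ∘ reverse) (reverse-map proj₂ (map f t)) ⟩
  concat (reverse (reverse (map proj₂ (map f t))))  ≡⟨ cong concat (reverse-involutive (map proj₂ (map f t))) ⟩
  concat (map proj₂ (map f t))                      ≡⟨ cong concat (map-∘ t) ⟨
  concatMap (reverse ∘ map (suc m ∸_)) t            ∎
  where
  open ≡-Reasoning
  f : List ℕ → ℕ × List ℕ
  f r = firstRowLength t ∸ length r , reverse (map (suc m ∸_) r)

module _ {m : ℕ} {p : ℕ → ℕ → ℕ} (gt : IsGT m p) where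

  GT-firstColumn-≤ : ∀ k i → 1 ≤ i → k + i ≤ m → p i 1 ≤ p (k + i) 1
  GT-firstColumn-≤ zero i _ _ = ≤-refl
  GT-firstColumn-≤ (suc k) i 1≤i k+i<m =
    ≤-trans (GT-firstColumn-≤ k i 1≤i (≤-trans (n≤1+n _) k+i<m))
            (proj₁ (gt (k + i) 1 (s≤s z≤n) (≤-trans 1≤i (m≤n+m i k)) k+i<m))

  -- p i j ≤ p (i − 1) (j − 1) ≤ ⋯ ≤ p (i − j + 1) 1 ≤ ⋯ ≤ p m 1.
  GT-≤-corner : ∀ j i → 1 ≤ j → j ≤ i → i ≤ m → p i j ≤ p m 1
  GT-≤-corner (suc zero) i _ 1≤i i≤m =
    subst (λ t → p i 1 ≤ p t 1) (m∸n+n≡m i≤m) (GT-firstColumn-≤ (m ∸ i) i 1≤i (≤-reflexive (m∸n+n≡m i≤m)))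
  GT-≤-corner (suc (suc j)) (suc i) _ (s≤s j<i) i<m =
    ≤-trans (proj₂ (gt i (suc j) (s≤s z≤n) j<i i<m)) (GT-≤-corner (suc j) i (s≤s z≤n) j<i (≤-trans (n≤1+n i) i<m))

  Ppart-≤-corner : ∀ i j → i ≤ m → Ppart p i j ≤ p m 1
  Ppart-≤-corner i j i≤m with 1 ≤ᵇ j in e₁ | j ≤ᵇ i in e₂
  ... | true | true = GT-≤-corner j i (≤ᵇ⇒≤ 1 j (subst True (sym e₁) tt)) (≤ᵇ⇒≤ j i (subst True (sym e₂) tt)) i≤m
  ... | true | false = z≤n
  ... | false | _ = z≤n

module _ (m : ℕ) (p : ℕ → ℕ → ℕ) where

  T-row : ℕ → List ℕ
  T-row j = concatMap (λ i → replicate (Ppart p i j ∸ Ppart p (i ∸ 1) j) i) (range1 m)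

  C-multiplicity : ℕ → ℕ → ℕ
  C-multiplicity r k = Qpart m (p m 1) p (m ∸ k) r ∸ Qpart m (p m 1) p (suc m ∸ k) r

  C-row : ℕ → List ℕ
  C-row r = concatMap (λ k → replicate (C-multiplicity r k) k) (range1 m)

  -- (K − a) − (K − b) = b − a, which needs b ≤ K = p m 1.
  T-multiplicity≡C-multiplicity : IsGT m p → ∀ j k → j < m → k < m →
    Ppart p (m ∸ k) (suc j) ∸ Ppart p ((m ∸ k) ∸ 1) (suc j) ≡ C-multiplicity (m ∸ j) (suc k)
  T-multiplicity≡C-multiplicity gt j k j<m k<m = begin
    Ppart p (m ∸ k) (suc j) ∸ Ppart p ((m ∸ k) ∸ 1) (suc j)
      ≡⟨ cong (λ i → Ppart p (m ∸ k) (suc j) ∸ Ppart p i (suc j)) ([m∸n]∸1≡m∸[1+n] m k) ⟩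
    Ppart p (m ∸ k) (suc j) ∸ Ppart p (m ∸ suc k) (suc j)
      ≡⟨ [o∸m]∸[o∸n]≡n∸m (p m 1) (Ppart p (m ∸ suc k) (suc j)) _ (Ppart-≤-corner gt (m ∸ k) (suc j) (m∸n≤m m k))
       ⟨
    (p m 1 ∸ Ppart p (m ∸ suc k) (suc j)) ∸ (p m 1 ∸ Ppart p (m ∸ k) (suc j))
      ≡⟨ cong (λ i → (p m 1 ∸ Ppart p (m ∸ suc k) i) ∸ (p m 1 ∸ Ppart p (m ∸ k) i)) (1+m∸[m∸n]≡1+n (<⇒≤ j<m))
       ⟨
    C-multiplicity (m ∸ j) (suc k)
      ∎
    where open ≡-Reasoning

  reverse-complement-T-row : IsGT m p → ∀ j → j < m → reverse (map (suc m ∸_) (T-row (suc j))) ≡ C-row (m ∸ j)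
  reverse-complement-T-row gt j j<m = begin
    reverse (map (suc m ∸_) (T-row (suc j)))            ≡⟨ reverse-map-concatMap-replicate (suc m ∸_) d (range1 m) ⟩
    concatMap (λ i → replicate (d i) (suc m ∸ i)) (reverse (range1 m))
                                                        ≡⟨ cong (concatMap _) (reverse-range1 m) ⟩
    concatMap (λ i → replicate (d i) (suc m ∸ i)) (applyUpTo (m ∸_) m)
                                                        ≡⟨ cong concat (map-applyUpTo (m ∸_) _ m) ⟩
    concat (applyUpTo (λ k → replicate (d (m ∸ k)) (suc m ∸ (m ∸ k))) m)
                                                        ≡⟨ cong concat (applyUpTo-cong _ _ m reindex) ⟩
    concat (applyUpTo (λ k → replicate (C-multiplicity (m ∸ j) (suc k)) (suc k)) m)
                                                        ≡⟨ cong concat (map-applyUpTo suc _ m) ⟨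
    C-row (m ∸ j)                                       ∎
    where
    open ≡-Reasoning
    d : ℕ → ℕ
    d i = Ppart p i (suc j) ∸ Ppart p (i ∸ 1) (suc j)
    reindex : ∀ k → k < m →
      replicate (d (m ∸ k)) (suc m ∸ (m ∸ k)) ≡ replicate (C-multiplicity (m ∸ j) (suc k)) (suc k)
    reindex k k<m = cong₂ replicate (T-multiplicity≡C-multiplicity gt j k j<m k<m) (1+m∸[m∸n]≡1+n (<⇒≤ k<m))

  readingWord-rotateComplement-T≡readingWord-C : IsGT m p → readingWord (rotateComplement m (T m p)) ≡ readingWord (C m p)
  readingWord-rotateComplement-T≡readingWord-C gt = begin
    readingWord (rotateComplement m (T m p))
      ≡⟨ readingWord-rotateComplement m (T m p) ⟩
    concatMap (reverse ∘ map (suc m ∸_)) (map T-row (range1 m))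
      ≡⟨ cong concat (map-∘ (range1 m)) ⟨
    concatMap (λ j → reverse (map (suc m ∸_) (T-row j))) (range1 m)
      ≡⟨ cong concat (map-applyUpTo suc _ m) ⟩
    concat (applyUpTo (λ j → reverse (map (suc m ∸_) (T-row (suc j)))) m)
      ≡⟨ cong concat (applyUpTo-cong _ _ m (reverse-complement-T-row gt)) ⟩
    concat (applyUpTo (C-row ∘ (m ∸_)) m)
      ≡⟨ cong concat (map-applyUpTo (m ∸_) C-row m) ⟨
    concatMap C-row (applyUpTo (m ∸_) m)
      ≡⟨ cong (concatMap C-row) (reverse-range1 m) ⟨
    concatMap C-row (reverse (range1 m))
      ≡⟨ cong concat (reverse-map C-row (range1 m)) ⟩
    concat (reverse (map C-row (range1 m)))
      ≡⟨ cong (concat ∘ reverse) (map-∘ (range1 m)) ⟩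
    readingWord (C m p)
      ∎
    where open ≡-Reasoning

proposition4p2 : (m : ℕ) (p : ℕ → ℕ → ℕ) → 1 ≤ m → IsGT m p →
    Σ Tableau (λ Y → IsSchutz m (T m p) Y × IsRect (C m p) Y)
    × ((Y Z : Tableau) → IsSchutz m (T m p) Y → IsRect (C m p) Z → Y ≡ Z)
proposition4p2 m p _ gt = (rect[C] , S[T]≡rect[C] , IsRect[C]) , unique
  where
  rotated : SkewTableau
  rotated = rotateComplement m (T m p)
  words-agree : readingWord rotated ≡ readingWord (C m p)
  words-agree = readingWord-rotateComplement-T≡readingWord-C m p gt
  rect[C] : Tableau
  rect[C] = insertionTableau (readingWord (C m p))
  IsRect[C] : IsRect (C m p) rect[C]
  IsRect[C] = IsRect-insertionTableau (C m p)
  S[T]≡rect[C] : IsSchutz m (T m p) rect[C]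
  S[T]≡rect[C] = IsRect-readingWord (C m p) rotated (sym words-agree) IsRect[C]
  unique : (Y Z : Tableau) → IsSchutz m (T m p) Y → IsRect (C m p) Z → Y ≡ Z
  unique Y Z S[T]≡Y rect[C]≡Z = begin
    Y                                                 ≡⟨ IsRect⇒≡insertionTableau rotated S[T]≡Y ⟩
    insertionTableau (readingWord rotated)            ≡⟨ cong insertionTableau words-agree ⟩
    insertionTableau (readingWord (C m p))            ≡⟨ IsRect⇒≡insertionTableau (C m p) rect[C]≡Z ⟨
    Z                                                 ∎
    where open ≡-Reasoning
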